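{- Let $\mathcal{I}=(V,d,k)$ be a $2$-metric perturbation resilient Asymmetric $k$-Center instance with unique optimal clustering $\mathcal{C}=\{C_1,\dots,C_k\}$ induced by the set of centers $S=\{c_1,\dots,c_k\}$, and optimal radius $r^*_d$. Suppose $p\in C_i$ and $q\in C_j$ with $i\ne j$, $d(p,c_i)\le r^*_d$ and $d(q,c_j)\le r^*_d$. Then for every $w\in C_i$ with $d(p,w)\ge r^*_d$ we have $d(q,w)>r^*_d$.
   Context: An Asymmetric $k$-Center instance $(V,d,k)$: $V$ finite, $d:V\times V\to\mathbb{R}_{\ge0}$ satisfies the triangle inequality but not necessarily symmetry. For centers $S=\{c_1,\dots,c_k\}\subseteq V$ (distinct), a Voronoi partition assigns each point $u$ to a center minimizing $d(c_i,u)$; the cost is $\max_i\max_{u\in C_i}d(c_i,u)$. The optimal clustering is the Voronoi partition induced by an optimal set of centers and $r^*_d$ is the optimal cost. The instance is $2$-metric perturbation resilient if for every $d'$ satisfying the triangle inequality with $d(u,v)/2\le d'(u,v)\le d(u,v)$ for all $u,v$, the unique optimal clustering of $(V,d',k)$ equals the unique optimal clustering of $(V,d,k)$.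
   Formalization: The distances d, the optimal radius $r^*_d$ and the perturbed distances d' are taken in the rationals instead of the reals. -}

module Defs where

open import Data.Nat using (ℕ)
open import Data.Fin using (Fin)
open import Data.Rational using (ℚ; 0ℚ; ½; _≤_; _*_)
open import Data.Product using (Σ; ∃; _×_)
open import Relation.Binary.PropositionalEquality using (_≡_)
open import Function.Definitions using (Injective)
open import Function.Bundles using (_⇔_)

Dist : ℕ → Set
Dist n = Fin n → Fin n → ℚ

IsAsymMetric : ∀ {n} → Dist n → Set
IsAsymMetric {n} d =
  (∀ u v → 0ℚ ≤ d u v) ×
  (∀ u → d u u ≡ 0ℚ) ×
  (∀ u v w → d u w ≤ (d u v Data.Rational.+ d v w))

Centers : ℕ → ℕ → Set
Centers n k = Σ (Fin k → Fin n) λ c → Injective _≡_ _≡_ c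

-- A clustering given as a cluster-label assignment σ : V → Fin k
-- (cluster i is σ⁻¹(i)).
Assignment : ℕ → ℕ → Set
Assignment n k = Fin n → Fin k

IsVoronoi : ∀ {n k} → Dist n → (Fin k → Fin n) → Assignment n k → Set
IsVoronoi d c σ = ∀ u j → d (c (σ u)) u ≤ d (c j) u

Covers : ∀ {n k} → Dist n → (Fin k → Fin n) → ℚ → Set
Covers d c r = ∀ u → ∃ λ j → d (c j) u ≤ r

IsOptRadius : ∀ {n} → Dist n → (k : ℕ) → ℚ → Set
IsOptRadius {n} d k r =
  (Σ (Centers n k) λ S → Covers d (Data.Product.proj₁ S) r) ×
  (∀ (S : Centers n k) r' → Covers d (Data.Product.proj₁ S) r' → r ≤ r')

IsOptCentersWith : ∀ {n k} → Dist n → Centers n k → Assignment n k → Set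
IsOptCentersWith {n} {k} d S σ =
  IsVoronoi d (Data.Product.proj₁ S) σ ×
  (∀ (S' : Centers n k) r' → Covers d (Data.Product.proj₁ S') r' →
     ∀ u → d (Data.Product.proj₁ S (σ u)) u ≤ r')

IsOptClustering : ∀ {n k} → Dist n → Assignment n k → Set
IsOptClustering {n} {k} d σ = Σ (Centers n k) λ S → IsOptCentersWith d S σ

-- Two assignments induce the same partition of V (clusters are unlabeled).
SamePartition : ∀ {n k} → Assignment n k → Assignment n k → Set
SamePartition σ τ = ∀ u v → (σ u ≡ σ v) ⇔ (τ u ≡ τ v)

IsUniqueOptClustering : ∀ {n k} → Dist n → Assignment n k → Set
IsUniqueOptClustering {n} {k} d σ =
  IsOptClustering d σ × (∀ (τ : Assignment n k) → IsOptClustering d τ → SamePartition τ σ)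

Is2PR : ∀ {n k} → Dist n → Assignment n k → Set
Is2PR {n} {k} d σ =
  IsUniqueOptClustering d σ ×
  (∀ (d' : Dist n) → IsAsymMetric d' →
     (∀ u v → (½ * d u v) ≤ d' u v × d' u v ≤ d u v) →
     IsUniqueOptClustering d' σ)

{-# OPTIONS --safe #-}
module Submission where

-- Suppose d(q, w) ≤ r, so that d(c_j, w) ≤ 2r. The perturbation
-- x ↦ max(x/2, min(x, r)) of d fixes distances below r, so its optimal radius
-- is still r, and collapses distances in [r, 2r] to r, so w becomes at least
-- as close to c_j as to p. Moving the i-th center to p therefore yields an
-- optimal clustering of the perturbed instance with p in cluster i and w
-- outside it, although p, w ∈ C_i. This needs p ≠ w and p not already another
-- center; in those degenerate cases p is at distance 0 from a second center,
-- and reassigning p to it is another optimal clustering of d itself.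

open import Defs
open import Data.Nat using (ℕ)
open import Data.Fin using (Fin; _≟_)
open import Data.Fin.Properties using (any?)
open import Data.Rational using (ℚ; 0ℚ; ½; _≤_; _<_; _+_; _*_; _⊓_; _⊔_)
open import Data.Rational.Properties hiding (_≟_)
open import Data.Product using (_,_; ∃; _×_; proj₁; proj₂)
open import Data.Sum using (_⊎_; inj₁; inj₂)
open import Data.Empty using (⊥; ⊥-elim)
open import Data.List using (allFin)
open import Relation.Binary.Bundles using (DecTotalOrder)
open import Data.List.Extrema (DecTotalOrder.totalOrder ≤-decTotalOrder)
  using (argmin; f[argmin]≤f[xs])
import Data.List.Relation.Unary.All as All
open import Data.List.Membership.Propositional.Properties using (∈-allFin)
open import Data.Vec.Functional using (updateAt)
open import Data.Vec.Functional.Properties using (updateAt-updates; updateAt-minimal)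
open import Relation.Nullary using (Dec; yes; no; ¬_; ¬?)
open import Relation.Nullary.Decidable using (_×-dec_)
open import Relation.Binary.PropositionalEquality
  using (_≡_; _≢_; refl; sym; trans; cong; cong₂; subst; subst₂)
open import Function using (const; _∘_)
open import Function.Definitions using (Injective)
open import Function.Bundles using (Equivalence; _⇔_; mk⇔)

½*p≥0 : ∀ {p} → 0ℚ ≤ p → 0ℚ ≤ ½ * p
½*p≥0 {p} p≥0 = subst (_≤ ½ * p) (*-zeroʳ ½) (*-monoˡ-≤-nonNeg ½ p≥0)

½*p+½*p≡p : ∀ p → ½ * p + ½ * p ≡ p
½*p+½*p≡p p = trans (sym (*-distribʳ-+ p ½ ½)) (*-identityˡ p)

½*[p+p]≡p : ∀ p → ½ * (p + p) ≡ p
½*[p+p]≡p p = trans (*-distribˡ-+ ½ p p) (½*p+½*p≡p p)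

½*p≤p : ∀ {p} → 0ℚ ≤ p → ½ * p ≤ p
½*p≤p {p} p≥0 = begin
  ½ * p          ≡⟨ +-identityʳ (½ * p) ⟨
  ½ * p + 0ℚ     ≤⟨ +-monoʳ-≤ (½ * p) (½*p≥0 p≥0) ⟩
  ½ * p + ½ * p  ≡⟨ ½*p+½*p≡p p ⟩
  p              ∎
  where open ≤-Reasoning

⊓-subadditive : ∀ {p q r} → 0ℚ ≤ p → 0ℚ ≤ q → 0ℚ ≤ r →
                (p + q) ⊓ r ≤ p ⊓ r + q ⊓ r
⊓-subadditive {p} {q} {r} p≥0 q≥0 r≥0 = by-cases (⊓-sel p r) (⊓-sel q r)
  where
  truncated : ∀ a b → a ⊓ r ≡ r → 0ℚ ≤ b ⊓ r → (a + b) ⊓ r ≤ a ⊓ r + b ⊓ r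
  truncated a b a⊓r≡r b⊓r≥0 = begin
    (a + b) ⊓ r    ≤⟨ p⊓q≤q (a + b) r ⟩
    r              ≡⟨ +-identityʳ r ⟨
    r + 0ℚ         ≤⟨ +-monoʳ-≤ r b⊓r≥0 ⟩
    r + b ⊓ r      ≡⟨ cong (_+ b ⊓ r) a⊓r≡r ⟨
    a ⊓ r + b ⊓ r  ∎
    where open ≤-Reasoning

  by-cases : p ⊓ r ≡ p ⊎ p ⊓ r ≡ r → q ⊓ r ≡ q ⊎ q ⊓ r ≡ r →
             (p + q) ⊓ r ≤ p ⊓ r + q ⊓ r
  by-cases (inj₂ p⊓r≡r) _ = truncated p q p⊓r≡r (⊓-glb q≥0 r≥0)
  by-cases _ (inj₂ q⊓r≡r) =
    subst₂ _≤_ (cong (_⊓ r) (+-comm q p)) (+-comm (q ⊓ r) (p ⊓ r))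
      (truncated q p q⊓r≡r (⊓-glb p≥0 r≥0))
  by-cases (inj₁ p⊓r≡p) (inj₁ q⊓r≡q) =
    subst ((p + q) ⊓ r ≤_) (sym (cong₂ _+_ p⊓r≡p q⊓r≡q)) (p⊓q≤p (p + q) r)

shrink : ℚ → ℚ → ℚ
shrink r p = (½ * p) ⊔ (p ⊓ r)

½*p≤shrink : ∀ r p → ½ * p ≤ shrink r p
½*p≤shrink r p = p≤p⊔q (½ * p) (p ⊓ r)

p⊓r≤shrink : ∀ r p → p ⊓ r ≤ shrink r p
p⊓r≤shrink r p = p≤q⊔p (½ * p) (p ⊓ r)

shrink≤ : ∀ r {p} → 0ℚ ≤ p → shrink r p ≤ p
shrink≤ r {p} p≥0 = ⊔-lub (½*p≤p p≥0) (p⊓q≤p p r)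

shrink-nonNeg : ∀ r {p} → 0ℚ ≤ p → 0ℚ ≤ shrink r p
shrink-nonNeg r {p} p≥0 = ≤-trans (½*p≥0 p≥0) (½*p≤shrink r p)

shrink-0 : ∀ r → shrink r 0ℚ ≡ 0ℚ
shrink-0 r = ≤-antisym (shrink≤ r ≤-refl) (shrink-nonNeg r ≤-refl)

shrink-mono-≤ : ∀ r {p q} → p ≤ q → shrink r p ≤ shrink r q
shrink-mono-≤ r p≤q = ⊔-mono-≤ (*-monoˡ-≤-nonNeg ½ p≤q) (⊓-mono-≤ p≤q ≤-refl)

shrink-subadditive : ∀ {r p q} → 0ℚ ≤ r → 0ℚ ≤ p → 0ℚ ≤ q →
                     shrink r (p + q) ≤ shrink r p + shrink r q
shrink-subadditive {r} {p} {q} r≥0 p≥0 q≥0 = ⊔-lub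
  (begin
    ½ * (p + q)            ≡⟨ *-distribˡ-+ ½ p q ⟩
    ½ * p + ½ * q          ≤⟨ +-mono-≤ (½*p≤shrink r p) (½*p≤shrink r q) ⟩
    shrink r p + shrink r q ∎)
  (begin
    (p + q) ⊓ r            ≤⟨ ⊓-subadditive p≥0 q≥0 r≥0 ⟩
    p ⊓ r + q ⊓ r          ≤⟨ +-mono-≤ (p⊓r≤shrink r p) (p⊓r≤shrink r q) ⟩
    shrink r p + shrink r q ∎)
  where open ≤-Reasoning

shrink≤r : ∀ {r p} → p ≤ r + r → shrink r p ≤ r
shrink≤r {r} {p} p≤2r =
  ⊔-lub (subst (½ * p ≤_) (½*[p+p]≡p r) (*-monoˡ-≤-nonNeg ½ p≤2r)) (p⊓q≤q p r)

r≤shrink : ∀ {r p} → r ≤ p → r ≤ shrink r p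
r≤shrink {r} {p} r≤p = ≤-trans (⊓-glb r≤p ≤-refl) (p⊓r≤shrink r p)

shrink[p]≤s<r⇒p≤s : ∀ {r p s} → shrink r p ≤ s → s < r → p ≤ s
shrink[p]≤s<r⇒p≤s {r} {p} {s} shrink≤s s<r with ⊓-sel p r
... | inj₁ p⊓r≡p = subst (_≤ s) p⊓r≡p p⊓r≤s
  where p⊓r≤s = ≤-trans (p⊓r≤shrink r p) shrink≤s
... | inj₂ p⊓r≡r = ⊥-elim (<-irrefl refl (≤-<-trans r≤s s<r))
  where r≤s = subst (_≤ s) p⊓r≡r (≤-trans (p⊓r≤shrink r p) shrink≤s)

shrinkDist : ∀ {n} → ℚ → Dist n → Dist n
shrinkDist r d u v = shrink r (d u v)

module _ {n} {d : Dist n} (d-metric : IsAsymMetric d) where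

  dist-nonNeg : ∀ u v → 0ℚ ≤ d u v
  dist-nonNeg = proj₁ d-metric

  dist-refl : ∀ u → d u u ≡ 0ℚ
  dist-refl = proj₁ (proj₂ d-metric)

  dist-triangle : ∀ u v w → d u w ≤ d u v + d v w
  dist-triangle = proj₂ (proj₂ d-metric)

  shrinkDist-isAsymMetric : ∀ {r} → 0ℚ ≤ r → IsAsymMetric (shrinkDist r d)
  shrinkDist-isAsymMetric {r} r≥0 =
      (λ u v → shrink-nonNeg r (dist-nonNeg u v))
    , (λ u → trans (cong (shrink r) (dist-refl u)) (shrink-0 r))
    , (λ u v w → ≤-trans (shrink-mono-≤ r (dist-triangle u v w))
                         (shrink-subadditive r≥0 (dist-nonNeg u v) (dist-nonNeg v w)))

  shrinkDist-within : ∀ r u v →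
                      ½ * d u v ≤ shrinkDist r d u v × shrinkDist r d u v ≤ d u v
  shrinkDist-within r u v = ½*p≤shrink r (d u v) , shrink≤ r (dist-nonNeg u v)

Nearest : ∀ {n k} → Dist n → (Fin k → Fin n) → Fin n → Fin k → Set
Nearest d c u a = ∀ l → d (c a) u ≤ d (c l) u

-- The label argument is only a default, needed because Fin k may be empty.
nearest : ∀ {n k} → Dist n → (Fin k → Fin n) → Fin k → Assignment n k
nearest {k = k} d c a u = argmin (λ l → d (c l) u) a (allFin k)

nearest-isVoronoi : ∀ {n k} (d : Dist n) (c : Fin k → Fin n) a →
                    IsVoronoi d c (nearest d c a)
nearest-isVoronoi {k = k} d c a u l =
  All.lookup (f[argmin]≤f[xs] {f = λ l → d (c l) u} a (allFin k)) (∈-allFin l)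

∃-nearest≢ : ∀ {n k} {d : Dist n} {c : Fin k → Fin n} {u i j} →
             i ≢ j → d (c j) u ≤ d (c i) u → ∃ λ b → b ≢ i × Nearest d c u b
∃-nearest≢ {d = d} {c} {u} {i} {j} i≢j cj≤ci with nearest d c i u ≟ i
... | no a≢i = nearest d c i u , a≢i , nearest-isVoronoi d c i u
... | yes a≡i = j , i≢j ∘ sym , λ l →
  ≤-trans cj≤ci (subst (λ a → d (c a) u ≤ d (c l) u) a≡i (nearest-isVoronoi d c i u l))

updateAt-isVoronoi : ∀ {n k} {d : Dist n} {c : Fin k → Fin n} {σ u a} →
                     IsVoronoi d c σ → Nearest d c u a →
                     IsVoronoi d c (updateAt σ u (const a))
updateAt-isVoronoi {d = d} {c} {σ} {u} σ-voronoi a-nearest v with v ≟ u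
... | yes refl = subst (Nearest d c v) (sym (updateAt-updates v σ)) a-nearest
... | no v≢u = subst (Nearest d c v) (sym (updateAt-minimal v u σ v≢u)) (σ-voronoi v)

voronoi-isOptClustering : ∀ {n k r} {d : Dist n} {τ : Assignment n k} → IsOptRadius d k r →
                          (S : Centers n k) → Covers d (proj₁ S) r →
                          IsVoronoi d (proj₁ S) τ → IsOptClustering d τ
voronoi-isOptClustering (_ , r-minimal) S S-covers τ-voronoi =
  S , τ-voronoi , λ S' r' S'-covers u →
    ≤-trans (τ-voronoi u (proj₁ (S-covers u)))
            (≤-trans (proj₂ (S-covers u)) (r-minimal S' r' S'-covers))

shrinkDist-isOptRadius : ∀ {n k r} {d : Dist n} → IsOptRadius d k r →
                         (S : Centers n k) → Covers (shrinkDist r d) (proj₁ S) r →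
                         IsOptRadius (shrinkDist r d) k r
shrinkDist-isOptRadius {n} {k} {r} {d} (_ , r-minimal) S S-covers = (S , S-covers) , r≤
  where
  r≤ : ∀ (S' : Centers n k) r' → Covers (shrinkDist r d) (proj₁ S') r' → r ≤ r'
  r≤ S' r' S'-covers with r ≤? r'
  ... | yes r≤r' = r≤r'
  ... | no r≰r' = r-minimal S' r' λ u →
    proj₁ (S'-covers u) , shrink[p]≤s<r⇒p≤s (proj₂ (S'-covers u)) (≰⇒> r≰r')

IsOtherCenter : ∀ {a} {A : Set a} {k} → (Fin k → A) → Fin k → A → Set a
IsOtherCenter c i x = ∃ λ m → m ≢ i × c m ≡ x

updateAt-injective : ∀ {a} {A : Set a} {k} {f : Fin k → A} {i x} →
                     Injective _≡_ _≡_ f → ¬ IsOtherCenter f i x →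
                     Injective _≡_ _≡_ (updateAt f i (const x))
updateAt-injective {f = f} {i} {x} f-inj x-fresh = g-injective
  where
  g = updateAt f i (const x)

  g≡f : ∀ {m} → m ≢ i → g m ≡ f m
  g≡f {m} m≢i = updateAt-minimal m i f m≢i

  g≢gi : ∀ {m} → m ≢ i → g m ≢ g i
  g≢gi m≢i gm≡gi =
    x-fresh (_ , m≢i , trans (sym (g≡f m≢i)) (trans gm≡gi (updateAt-updates i f)))

  g-injective : Injective _≡_ _≡_ g
  g-injective {a} {b} ga≡gb with a ≟ i | b ≟ i
  ... | yes refl | yes refl = refl
  ... | yes refl | no b≢i  = ⊥-elim (g≢gi b≢i (sym ga≡gb))
  ... | no a≢i   | yes refl = ⊥-elim (g≢gi a≢i ga≡gb)
  ... | no a≢i   | no b≢i  = f-inj (trans (sym (g≡f a≢i)) (trans ga≡gb (g≡f b≢i)))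

module Resilient {n k} {d : Dist n} (d-metric : IsAsymMetric d)
         {c : Fin k → Fin n} {c-inj : Injective _≡_ _≡_ c} {σ : Assignment n k} {r : ℚ}
         (r-opt : IsOptRadius d k r) (σ-opt : IsOptCentersWith d (c , c-inj) σ)
         (σ-2PR : Is2PR d σ)
  where

  cluster-radius : ∀ u → d (c (σ u)) u ≤ r
  cluster-radius = proj₂ σ-opt (proj₁ (proj₁ r-opt)) r (proj₂ (proj₁ r-opt))

  σ-covers : Covers d c r
  σ-covers u = σ u , cluster-radius u

  r-nonNeg : Fin n → 0ℚ ≤ r
  r-nonNeg u = ≤-trans (dist-nonNeg d-metric (c (σ u)) u) (cluster-radius u)

  -- Reassigning p to a center at distance 0 is another optimal clustering.
  zeroDistance-sameCluster : ∀ {a p u} → d (c a) p ≤ 0ℚ → u ≢ p →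
                             a ≡ σ u ⇔ σ p ≡ σ u
  zeroDistance-sameCluster {a} {p} {u} ca-p≤0 u≢p =
    mk⇔ (λ a≡σu → to (trans τp≡a (trans a≡σu (sym τu≡σu))))
        (λ σp≡σu → trans (sym τp≡a) (trans (from σp≡σu) τu≡σu))
    where
    τ = updateAt σ p (const a)
    τ-opt : IsOptClustering d τ
    τ-opt = voronoi-isOptClustering {d = d} r-opt (c , c-inj) σ-covers
              (updateAt-isVoronoi {d = d} (proj₁ σ-opt) λ l →
                 ≤-trans ca-p≤0 (dist-nonNeg d-metric (c l) p))
    open Equivalence (proj₂ (proj₁ σ-2PR) τ τ-opt p u)
    τp≡a : τ p ≡ a
    τp≡a = updateAt-updates p σ
    τu≡σu : τ u ≡ σ u
    τu≡σu = updateAt-minimal u p σ u≢p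

  replaceCenter-covers : ∀ {p i} → d p (c i) ≤ r →
                         Covers (shrinkDist r d) (updateAt c i (const p)) r
  replaceCenter-covers {p} {i} dpci≤r u with σ u ≟ i
  ... | yes σu≡i = i , subst (λ x → shrink r (d x u) ≤ r) (sym (updateAt-updates i c))
                         (shrink≤r (≤-trans (dist-triangle d-metric p (c i) u) dpci+dciu≤2r))
    where
    dciu≤r = subst (λ l → d (c l) u ≤ r) σu≡i (cluster-radius u)
    dpci+dciu≤2r = +-mono-≤ dpci≤r dciu≤r
  ... | no σu≢i = σ u , subst (λ x → shrink r (d x u) ≤ r)
                          (sym (updateAt-minimal (σ u) i c σu≢i))
                          (≤-trans (shrink≤ r (dist-nonNeg d-metric _ u)) (cluster-radius u))

  separating-optClustering :
    ∀ {p w i j} → d p (c i) ≤ r → ¬ IsOtherCenter c i p → w ≢ p → i ≢ j →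
    d (c j) w ≤ r + r → r ≤ d p w →
    ∃ λ τ → IsOptClustering (shrinkDist r d) τ × τ w ≢ τ p
  separating-optClustering {p} {w} {i} {j} dpci≤r p-fresh w≢p i≢j dcjw≤2r r≤dpw =
    τ , τ-opt , τw≢τp
    where
    open ≤-Reasoning
    d' = shrinkDist r d
    c' = updateAt c i (const p)

    c'i≡p : c' i ≡ p
    c'i≡p = updateAt-updates i c

    S : Centers n k
    S = c' , updateAt-injective c-inj p-fresh

    w-tie : d' (c' j) w ≤ d' (c' i) w
    w-tie = begin
      d' (c' j) w  ≡⟨ cong (λ x → d' x w) (updateAt-minimal j i c (i≢j ∘ sym)) ⟩
      d' (c j) w   ≤⟨ shrink≤r dcjw≤2r ⟩
      r            ≤⟨ r≤shrink r≤dpw ⟩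
      d' p w       ≡⟨ cong (λ x → d' x w) c'i≡p ⟨
      d' (c' i) w  ∎

    b-nearest : ∃ λ b → b ≢ i × Nearest d' c' w b
    b-nearest = ∃-nearest≢ {d = d'} i≢j w-tie

    p-nearest : Nearest d' c' p i
    p-nearest l = begin
      d' (c' i) p  ≡⟨ cong (λ x → d' x p) c'i≡p ⟩
      d' p p       ≡⟨ cong (shrink r) (dist-refl d-metric p) ⟩
      shrink r 0ℚ  ≡⟨ shrink-0 r ⟩
      0ℚ           ≤⟨ shrink-nonNeg r (dist-nonNeg d-metric (c' l) p) ⟩
      d' (c' l) p  ∎

    τ : Assignment n k
    τ = updateAt (updateAt (nearest d' c' i) w (const (proj₁ b-nearest))) p (const i)

    τ-voronoi : IsVoronoi d' c' τ
    τ-voronoi =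
      updateAt-isVoronoi {d = d'}
        (updateAt-isVoronoi {d = d'} (nearest-isVoronoi d' c' i) (proj₂ (proj₂ b-nearest)))
        p-nearest

    τ-opt : IsOptClustering d' τ
    τ-opt = voronoi-isOptClustering {d = d'}
              (shrinkDist-isOptRadius {d = d} r-opt S (replaceCenter-covers dpci≤r))
              S (replaceCenter-covers dpci≤r) τ-voronoi

    τw≡b : τ w ≡ proj₁ b-nearest
    τw≡b = trans (updateAt-minimal w p _ w≢p) (updateAt-updates w (nearest d' c' i))

    τw≢τp : τ w ≢ τ p
    τw≢τp τw≡τp =
      proj₁ (proj₂ b-nearest) (trans (sym τw≡b) (trans τw≡τp (updateAt-updates p _)))

  perturbation-separates :
    ∀ {p w i j} → d p (c i) ≤ r → ¬ IsOtherCenter c i p → w ≢ p → i ≢ j →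
    d (c j) w ≤ r + r → r ≤ d p w → σ w ≢ σ p
  perturbation-separates {p} {w} dpci≤r p-fresh w≢p i≢j dcjw≤2r r≤dpw σw≡σp =
    let τ , τ-opt , τw≢τp =
          separating-optClustering dpci≤r p-fresh w≢p i≢j dcjw≤2r r≤dpw
        τ≈σ = proj₂ (proj₂ σ-2PR (shrinkDist r d)
                                 (shrinkDist-isAsymMetric d-metric (r-nonNeg p))
                                 (shrinkDist-within d-metric r)) τ τ-opt
    in τw≢τp (Equivalence.from (τ≈σ w p) σw≡σp)

mainTheorem4 : ∀ {n k : ℕ} (d : Dist n) → IsAsymMetric d →
    (c : Fin k → Fin n) (cinj : Injective _≡_ _≡_ c) (σ : Assignment n k) (r : ℚ) →
    IsOptRadius d k r → IsOptCentersWith d (c , cinj) σ → Is2PR d σ →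
    ∀ (p q : Fin n) (i j : Fin k) → σ p ≡ i → σ q ≡ j → i ≢ j →
    d p (c i) ≤ r → d q (c j) ≤ r →
    ∀ (w : Fin n) → σ w ≡ i → r ≤ d p w → r < d q w
mainTheorem4 d d-metric c c-inj σ r r-opt σ-opt σ-2PR
             p q i j σp≡i σq≡j i≢j dpci≤r _ w σw≡i r≤dpw
  with d q w ≤? r
... | no dqw≰r = ≰⇒> dqw≰r
... | yes dqw≤r = ⊥-elim (by-cases (w ≟ p) (any? λ m → ¬? (m ≟ i) ×-dec (c m ≟ p)))
  where
  open Resilient d-metric {c-inj = c-inj} r-opt σ-opt σ-2PR
  open Equivalence using (to; from)

  σp≢σq : σ p ≢ σ q
  σp≢σq σp≡σq = i≢j (trans (sym σp≡i) (trans σp≡σq σq≡j))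

  dcjw≤2r : d (c j) w ≤ r + r
  dcjw≤2r = ≤-trans (dist-triangle d-metric (c j) q w)
              (+-mono-≤ (subst (λ l → d (c l) q ≤ r) σq≡j (cluster-radius q)) dqw≤r)

  σw≡σp : σ w ≡ σ p
  σw≡σp = trans σw≡i (sym σp≡i)

  q≢p : q ≢ p
  q≢p q≡p = σp≢σq (cong σ (sym q≡p))

  by-cases : Dec (w ≡ p) → Dec (IsOtherCenter c i p) → ⊥
  by-cases (yes refl) _ = σp≢σq (to (zeroDistance-sameCluster dcjp≤0 q≢p) (sym σq≡j))
    where
    r≤0 = subst (r ≤_) (dist-refl d-metric p) r≤dpw
    dcjp≤0 = ≤-trans dcjw≤2r (+-mono-≤ r≤0 r≤0)
  by-cases (no w≢p) (yes (m , m≢i , cm≡p)) =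
    m≢i (trans (from (zeroDistance-sameCluster dcmp≤0 w≢p) (sym σw≡σp)) σw≡i)
    where dcmp≤0 = ≤-reflexive (trans (cong (λ x → d x p) cm≡p) (dist-refl d-metric p))
  by-cases (no w≢p) (no p-fresh) =
    perturbation-separates dpci≤r p-fresh w≢p i≢j dcjw≤2r r≤dpw σw≡σp
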